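{- Let $N \geq 5$ and $3 \leq M \leq N$. Let $C_M^\circ$ be a cycle subgraph of $K_N$ (on $[N]$) with $M$ vertices and edge set $E_M^\circ$, with vertices labeled $v_0,\dots,v_{M-1}$ so that $v_iv_j \in E_M^\circ$ if and only if $j-i \equiv \pm 1 \pmod M$; indices of the $v$'s are taken modulo $M$. Define \[ \mathscr{X} = \{(N-2)\mathbf{e}_{v_i} + \mathbf{e}_j \in \mathbb{R}^N : 0 \leq i \leq M-1,\ j \in [N]\}, \] \[ \mathscr{Y} = \{r\mathbf{e}_{v_i} + (N-1-r)\mathbf{e}_{v_{i+2}} \in \mathbb{R}^N : 0 \le i \le M-1,\ 2 \leq r \leq N-3\}, \] \[ \mathscr{Z} = \{r\mathbf{e}_{v_i} + (N-2-r)\mathbf{e}_{v_{i+2}} + \mathbf{e}_s : 0 \le i \le M-1,\ 1 \leq r \leq N-3,\ s \in [N]\setminus\{v_i,v_{i+2}\}\}. \] Then \[ \mathfrak{D}(K_N) \setminus \mathfrak{D}(K_N \setminus E_M^\circ) = \begin{cases} \mathscr{X} \uplus \mathscr{Y} & \text{if } M \neq 4,\\ \mathscr{X} \uplus \mathscr{Y} \uplus \mathscr{Z} & \text{if } M = 4,\end{cases} \] where $\uplus$ denotes disjoint union.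
   Context: $\mathbf{e}_j$ is the $j$th standard basis vector of $\mathbb{R}^N$. $K_N \setminus E_M^\circ$ is the graph on $[N]$ obtained from $K_N$ by deleting the edges in $E_M^\circ$. For a simple graph $H$ on $[n]$, let $D(H)$ be the bipartite graph on $[n] \sqcup \{\bar 1,\dots,\bar n\}$ with edges $\{i,\bar i\}$ for every $i$, and $\{i,\bar j\}$, $\{j,\bar i\}$ for every edge $ij$ of $H$; $\mathcal{N}_{D(H)}(i)$ is the set of neighbors of $i$ in $D(H)$. A sequence $c \in \mathbb{Z}_{\geq 0}^n$ is $D(H)$-draconian if $\sum_i c_i = n-1$ and for every nonempty $S \subseteq [n]$, $\sum_{i \in S} c_i < \bigl|\bigcup_{i \in S}\mathcal{N}_{D(H)}(i)\bigr|$. $\mathfrak{D}(H)$ is the set of $D(H)$-draconian sequences. -}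

module Defs where

open import Data.Bool using (Bool; true; false; _∧_; _∨_; not; if_then_else_)
open import Data.Nat using (ℕ; zero; suc; _+_; _*_; _∸_; _≤_; _<_; NonZero)
open import Data.Nat.DivMod using (_%_; _mod_)
import Data.Nat as ℕ
open import Data.Fin using (Fin; toℕ)
import Data.Fin as F
open import Data.Fin.Subset using (Subset; ⋃; ∣_∣; Nonempty)
open import Data.List using (List; allFin)
open import Data.Bool.ListAction using (any)
import Data.List as L
open import Data.Vec using (tabulate; lookup)
import Data.Vec as V
open import Data.Product using (_×_; Σ; ∃; ∃-syntax)
open import Relation.Binary.PropositionalEquality using (_≡_; _≢_)
open import Relation.Nullary.Decidable using (⌊_⌋)

Graph : ℕ → Set
Graph n = Fin n → Fin n → Bool

sumF : ∀ {n} → (Fin n → ℕ) → ℕ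
sumF c = V.sum (tabulate c)

sumOn : ∀ {n} → Subset n → (Fin n → ℕ) → ℕ
sumOn S c = V.sum (tabulate (λ i → if lookup S i then c i else 0))

-- Neighbourhood in D(H) of the left vertex i, as a subset of the right part
-- {1̄,…,n̄} (right vertex j̄ identified with j : Fin n):
-- i̅ itself, and j̄ for every edge ij of H.
nbrD : ∀ {n} → Graph n → Fin n → Subset n
nbrD H i = tabulate (λ j → ⌊ i F.≟ j ⌋ ∨ H i j)

nbrUnionD : ∀ {n} → Graph n → Subset n → Subset n
nbrUnionD {n} H S = ⋃ (L.map (nbrD H) (L.filterᵇ (lookup S) (allFin n)))

Draconian : ∀ {n} → Graph n → (Fin n → ℕ) → Set
Draconian {n} H c =
  (sumF c ≡ n ∸ 1) ×
  (∀ (S : Subset n) → Nonempty S → sumOn S c < ∣ nbrUnionD H S ∣)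

K : (n : ℕ) → Graph n
K n i j = not ⌊ i F.≟ j ⌋

cycleEdge : ∀ {N} (M : ℕ) .{{_ : NonZero M}} → (Fin M → Fin N) → Fin N → Fin N → Bool
cycleEdge M v x y =
  any (λ a → any (λ b →
         ⌊ v a F.≟ x ⌋ ∧ ⌊ v b F.≟ y ⌋ ∧
         (⌊ suc (toℕ a) % M ℕ.≟ toℕ b ⌋ ∨ ⌊ suc (toℕ b) % M ℕ.≟ toℕ a ⌋))
       (allFin M)) (allFin M)

KminusCycle : (N M : ℕ) .{{_ : NonZero M}} → (Fin M → Fin N) → Graph N
KminusCycle N M v x y = K N x y ∧ not (cycleEdge M v x y)

e : ∀ {N} → Fin N → Fin N → ℕ
e j k = if ⌊ j F.≟ k ⌋ then 1 else 0

vmod : ∀ {N} (M : ℕ) .{{_ : NonZero M}} → (Fin M → Fin N) → ℕ → Fin N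
vmod M v k = v (k mod M)

InX : (N M : ℕ) .{{_ : NonZero M}} → (Fin M → Fin N) → (Fin N → ℕ) → Set
InX N M v c = Σ (Fin M) λ i → Σ (Fin N) λ j →
  ∀ k → c k ≡ (N ∸ 2) * e (v i) k + e j k

InY : (N M : ℕ) .{{_ : NonZero M}} → (Fin M → Fin N) → (Fin N → ℕ) → Set
InY N M v c = Σ (Fin M) λ i → Σ ℕ λ r → 2 ≤ r × r ≤ N ∸ 3 ×
  (∀ k → c k ≡ r * e (vmod M v (toℕ i)) k + (N ∸ 1 ∸ r) * e (vmod M v (toℕ i + 2)) k)

InZ : (N M : ℕ) .{{_ : NonZero M}} → (Fin M → Fin N) → (Fin N → ℕ) → Set
InZ N M v c = Σ (Fin M) λ i → Σ ℕ λ r → 1 ≤ r × r ≤ N ∸ 3 × Σ (Fin N) λ s →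
  s ≢ vmod M v (toℕ i) × s ≢ vmod M v (toℕ i + 2) ×
  (∀ k → c k ≡ r * e (vmod M v (toℕ i)) k + (N ∸ 2 ∸ r) * e (vmod M v (toℕ i + 2)) k + e s k)

module Submission where

-- Every c in 𝒳 ⊎ 𝒴 ⊎ 𝒵 has total mass N − 1, and that alone makes c D(K_N)-draconian, since in
-- D(K_N) every nonempty S sees all N right vertices.  In D(K_N ∖ E), a right vertex w̄ is missing
-- from the neighbourhood U of S exactly when every i ∈ S is a cycle-neighbour of w.  So if S violates
-- the draconian inequality, ∣U∣ ≤ c(S) ≤ N − 1 forces some missing w = v_x, and S ⊆ {v_{x−1}, v_{x+1}}.
-- A single vertex of S leaves at most two vertices missing, so it carries mass ≥ N − 2, which gives 𝒳.
-- If S = {v_{x−1}, v_{x+1}}, the missing vertices are common cycle-neighbours of both: only v_x, unless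
-- M = 4 where v_{x+2} is one as well.  Hence c(S) = N − 1, putting c on two vertices at distance 2
-- (𝒳 or 𝒴), or M = 4 and c(S) = N − 2 with one unit elsewhere (𝒳 or 𝒵).  The same sets S witness
-- that the elements of 𝒳, 𝒴, 𝒵 are not D(K_N ∖ E)-draconian; the three pieces are told apart by
-- their largest entry and by whether an entry equals 1.

import Algebra.Properties.CommutativeMonoid.Sum as CommutativeMonoidSum
open import Data.Bool using (Bool; true; false; not; T; _∧_; _∨_; if_then_else_)
open import Data.Bool.ListAction using (any)
open import Data.Bool.Properties using (T-≡; ∨-inverseʳ; ∧-identityʳ)
open import Data.Empty using (⊥-elim)
open import Data.Fin using (Fin; zero; suc; toℕ)
import Data.Fin as F
import Data.Fin.Properties as Finₚ
open import Data.Fin.Properties using (¬∀⟶∃¬)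
open import Data.Fin.Subset
  using (Subset; _∈_; _∉_; _⊆_; _⊂_; _∪_; ⋃; ⁅_⁆; ∁; ∣_∣; ⊤; inside; outside; Nonempty)
open import Data.Fin.Subset.Properties
  using (_∈?_; ∉⊥; nonempty?; anySubset?; ∣p∣≤∣x∷p∣; x∈⁅x⁆; x∈⁅y⁆⇒x≡y; ∣⁅x⁆∣≡1; ∣⊤∣≡n;
         p⊆q⇒∣p∣≤∣q∣; p⊂q⇒∣p∣<∣q∣; ∣∁p∣≡n∸∣p∣; x∈p∪q⁺; x∈p∪q⁻; p⊆p∪q; x∈p⇒x∉∁p; x∈∁p⇒x∉p; x∉p⇒x∈∁p)
open import Data.List using (List; []; _∷_; allFin; filterᵇ)
import Data.List as L
open import Data.List.Membership.Propositional using (lose) renaming (_∈_ to _∈ₗ_)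
open import Data.List.Membership.Propositional.Properties using (∈-allFin; ∈-map⁺; ∈-map⁻; ∈-filter⁺; ∈-filter⁻)
open import Data.List.Relation.Unary.Any using (here; there; satisfied)
open import Data.List.Relation.Unary.Any.Properties using (any⁺; any⁻)
open import Data.Nat using (ℕ; zero; suc; _+_; _*_; _∸_; _≤_; _<_; _≤?_; _<?_; z≤n; s≤s; NonZero; >-nonZero)
import Data.Nat as ℕ
open import Data.Nat.DivMod using (_%_; _mod_; %-distribˡ-+; m%n%n≡m%n; m<n⇒m%n≡m; m%n<n; m≤n⇒[n∸m]%m≡n%m; [m+n]%n≡m%n)
open import Data.Nat.Properties
open import Data.Product using (_×_; _,_; proj₁; proj₂; ∃-syntax; ∃₂; uncurry)
open import Data.Sum using (_⊎_; inj₁; inj₂; [_,_]′; map₂; swap)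
open import Data.Vec using ([]; _∷_; lookup)
open import Data.Vec.Properties using (lookup-map; lookup∘tabulate; lookup⇒[]=; []=⇒lookup)
open import Function using (_∘_; _$_; id)
open import Function.Bundles using (Equivalence)
open import Function.Definitions using (Injective)
open import Relation.Binary.PropositionalEquality hiding ([_])
open import Relation.Nullary using (Dec; yes; no; ¬_; contradiction)
open import Relation.Nullary.Decidable using (⌊_⌋; T?; dec-no; decidable-stable; _×-dec_)

open import Defs

open CommutativeMonoidSum +-0-commutativeMonoid using (sum; sum-cong-≗; ∑-distrib-+; sum-remove)

private variable n : ℕ

-- Basis vectors and finite sums

e-diag : (a : Fin n) → e a a ≡ 1
e-diag a with a F.≟ a
... | yes _ = refl
... | no a≢a = contradiction refl a≢a

e-off : {a k : Fin n} → a ≢ k → e a k ≡ 0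
e-off {a = a} {k} a≢k with a F.≟ k
... | yes a≡k = contradiction a≡k a≢k
... | no _ = refl

e-suc : (a k : Fin n) → e (suc a) (suc k) ≡ e a k
e-suc a k = by-cases (a F.≟ k)
  where
  by-cases : Dec (a ≡ k) → e (suc a) (suc k) ≡ e a k
  by-cases (yes refl) = trans (e-diag (suc a)) (sym (e-diag a))
  by-cases (no a≢k) = trans (e-off (a≢k ∘ Finₚ.suc-injective)) (sym (e-off a≢k))

*-e-diag : ∀ x (a : Fin n) → x * e a a ≡ x
*-e-diag x a = trans (cong (x *_) (e-diag a)) (*-identityʳ x)

*-e-off : ∀ x {a k : Fin n} → a ≢ k → x * e a k ≡ 0
*-e-off x a≢k = trans (cong (x *_) (e-off a≢k)) (*-zeroʳ x)

≤*e : ∀ x (a : Fin n) → x ≤ x * e a a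
≤*e x a = ≤-reflexive (sym (*-e-diag x a))

*e+*e-values : {a b : Fin n} → a ≢ b → ∀ x y k →
  x * e a k + y * e b k ≡ x ⊎ x * e a k + y * e b k ≡ y ⊎ x * e a k + y * e b k ≡ 0
*e+*e-values {a = a} {b} a≢b x y k with a F.≟ k | b F.≟ k
... | yes refl | yes refl = contradiction refl a≢b
... | yes refl | no _ = inj₁ (trans (cong₂ _+_ (*-identityʳ x) (*-zeroʳ y)) (+-identityʳ x))
... | no _ | yes refl = inj₂ (inj₁ (cong₂ _+_ (*-zeroʳ x) (*-identityʳ y)))
... | no _ | no _ = inj₂ (inj₂ (cong₂ _+_ (*-zeroʳ x) (*-zeroʳ y)))

*e+*e≤ : ∀ {a b : Fin n} {x y B} → a ≢ b → x ≤ B → y ≤ B → ∀ k → x * e a k + y * e b k ≤ B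
*e+*e≤ {x = x} {y} {B} a≢b x≤B y≤B k with *e+*e-values a≢b x y k
... | inj₁ ≡x = subst (_≤ B) (sym ≡x) x≤B
... | inj₂ (inj₁ ≡y) = subst (_≤ B) (sym ≡y) y≤B
... | inj₂ (inj₂ ≡0) = subst (_≤ B) (sym ≡0) z≤n

*e+*e≢1 : ∀ {a b : Fin n} {x y} → a ≢ b → x ≢ 1 → y ≢ 1 → ∀ k → x * e a k + y * e b k ≢ 1
*e+*e≢1 {x = x} {y} a≢b x≢1 y≢1 k with *e+*e-values a≢b x y k
... | inj₁ ≡x = x≢1 ∘ trans (sym ≡x)
... | inj₂ (inj₁ ≡y) = y≢1 ∘ trans (sym ≡y)
... | inj₂ (inj₂ ≡0) = λ ≡1 → contradiction (trans (sym ≡0) ≡1) λ ()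

2≤⇒≢1 : ∀ {x} → 2 ≤ x → x ≢ 1
2≤⇒≢1 (s≤s ()) refl

sumF≡sum : (c : Fin n → ℕ) → sumF c ≡ sum c
sumF≡sum {zero} c = refl
sumF≡sum {suc n} c = cong (c zero +_) (sumF≡sum (c ∘ suc))

sum-mono-≤ : {f g : Fin n → ℕ} → (∀ k → f k ≤ g k) → sum f ≤ sum g
sum-mono-≤ {zero} f≤g = z≤n
sum-mono-≤ {suc n} f≤g = +-mono-≤ (f≤g zero) (sum-mono-≤ (f≤g ∘ suc))

sum-zero : {t : Fin n → ℕ} → (∀ k → t k ≡ 0) → sum t ≡ 0
sum-zero {zero} t≡0 = refl
sum-zero {suc n} t≡0 = cong₂ _+_ (t≡0 zero) (sum-zero (t≡0 ∘ suc))

≤sum : (t : Fin n → ℕ) (i : Fin n) → t i ≤ sum t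
≤sum {suc n} t i = ≤-trans (m≤m+n (t i) _) (≤-reflexive (sym (sum-remove {i = i} t)))

sum≡0⇒≡0 : (t : Fin n → ℕ) → sum t ≡ 0 → ∀ k → t k ≡ 0
sum≡0⇒≡0 t Σt≡0 k = n≤0⇒n≡0 (subst (t k ≤_) Σt≡0 (≤sum t k))

sum-supported : (t : Fin n → ℕ) (a : Fin n) → (∀ k → a ≢ k → t k ≡ 0) → sum t ≡ t a
sum-supported t zero t≡0 =
  trans (cong (t zero +_) (sum-zero (λ k → t≡0 (suc k) λ ()))) (+-identityʳ (t zero))
sum-supported t (suc a) t≡0 =
  cong₂ _+_ (t≡0 zero λ ()) (sum-supported (t ∘ suc) a (λ k a≢k → t≡0 (suc k) (a≢k ∘ Finₚ.suc-injective)))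

sum-e : (a : Fin n) → sum (e a) ≡ 1
sum-e a = trans (sum-supported (e a) a (λ k → e-off)) (e-diag a)

sum-*e : ∀ x (a : Fin n) → sum (λ k → x * e a k) ≡ x
sum-*e x a = trans (sum-supported _ a (λ k → *-e-off x)) (*-e-diag x a)

sum-*e+*e : ∀ x y (a b : Fin n) → sum (λ k → x * e a k + y * e b k) ≡ x + y
sum-*e+*e x y a b = trans (∑-distrib-+ (λ k → x * e a k) (λ k → y * e b k)) (cong₂ _+_ (sum-*e x a) (sum-*e y b))

sum≡1⇒≡e : (t : Fin n → ℕ) → sum t ≡ 1 → ∃[ j ] ∀ k → t k ≡ e j k
sum≡1⇒≡e {suc n} t Σt≡1 with t zero in t₀≡
... | zero with sum≡1⇒≡e (t ∘ suc) Σt≡1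
...   | j , t∘suc≡e = suc j , λ { zero → t₀≡ ; (suc k) → trans (t∘suc≡e k) (sym (e-suc j k)) }
sum≡1⇒≡e {suc n} t Σt≡1 | suc zero =
  zero , λ { zero → t₀≡ ; (suc k) → sum≡0⇒≡0 (t ∘ suc) (suc-injective Σt≡1) k }

-- Restricting a sequence to a subset

restrict : Subset n → (Fin n → ℕ) → Fin n → ℕ
restrict S c k = if lookup S k then c k else 0

restrict-∈ : (S : Subset n) (c : Fin n → ℕ) {k : Fin n} → k ∈ S → restrict S c k ≡ c k
restrict-∈ S c k∈S rewrite []=⇒lookup k∈S = refl

restrict-∉ : (S : Subset n) (c : Fin n → ℕ) {k : Fin n} → k ∉ S → restrict S c k ≡ 0
restrict-∉ S c {k} k∉S with lookup S k in Sk
... | true = contradiction (lookup⇒[]= k S Sk) k∉S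
... | false = refl

restrict+restrict-∁ : (S : Subset n) (c : Fin n → ℕ) (k : Fin n) → restrict S c k + restrict (∁ S) c k ≡ c k
restrict+restrict-∁ S c k rewrite lookup-map k not S with lookup S k
... | true = +-identityʳ (c k)
... | false = refl

restrict-≤ : (S : Subset n) (c : Fin n → ℕ) (k : Fin n) → restrict S c k ≤ c k
restrict-≤ S c k with lookup S k
... | true = ≤-refl
... | false = z≤n

sumOn≡sum : (S : Subset n) (c : Fin n → ℕ) → sumOn S c ≡ sum (restrict S c)
sumOn≡sum S c = sumF≡sum (restrict S c)

sumOn≤sumF : (S : Subset n) (c : Fin n → ℕ) → sumOn S c ≤ sumF c
sumOn≤sumF S c = begin
  sumOn S c             ≡⟨ sumOn≡sum S c ⟩
  sum (restrict S c)    ≤⟨ sum-mono-≤ (restrict-≤ S c) ⟩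
  sum c                 ≡⟨ sumF≡sum c ⟨
  sumF c                ∎
  where open ≤-Reasoning

∈⇒≤sumOn : (S : Subset n) (c : Fin n → ℕ) {a : Fin n} → a ∈ S → c a ≤ sumOn S c
∈⇒≤sumOn S c {a} a∈S = begin
  c a                   ≡⟨ restrict-∈ S c a∈S ⟨
  restrict S c a        ≤⟨ ≤sum (restrict S c) a ⟩
  sum (restrict S c)    ≡⟨ sumOn≡sum S c ⟨
  sumOn S c             ∎
  where open ≤-Reasoning

sumF≡sumOn+sumOn∁ : (S : Subset n) (c : Fin n → ℕ) → sumF c ≡ sumOn S c + sumOn (∁ S) c
sumF≡sumOn+sumOn∁ S c = begin
  sumF c                                       ≡⟨ sumF≡sum c ⟩
  sum c                                        ≡⟨ sum-cong-≗ (restrict+restrict-∁ S c) ⟨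
  sum (λ k → restrict S c k + restrict (∁ S) c k) ≡⟨ ∑-distrib-+ (restrict S c) (restrict (∁ S) c) ⟩
  sum (restrict S c) + sum (restrict (∁ S) c)  ≡⟨ cong₂ _+_ (sumOn≡sum S c) (sumOn≡sum (∁ S) c) ⟨
  sumOn S c + sumOn (∁ S) c                    ∎
  where open ≡-Reasoning

sumOn-⊆⁅⁆ : (S : Subset n) (c : Fin n → ℕ) {a : Fin n} → (∀ {k} → k ∈ S → k ≡ a) → sumOn S c ≤ c a
sumOn-⊆⁅⁆ S c {a} S⊆a = begin
  sumOn S c             ≡⟨ sumOn≡sum S c ⟩
  sum (restrict S c)    ≡⟨ sum-supported (restrict S c) a (λ k a≢k → restrict-∉ S c (λ k∈S → a≢k (sym (S⊆a k∈S)))) ⟩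
  restrict S c a        ≤⟨ restrict-≤ S c a ⟩
  c a                   ∎
  where open ≤-Reasoning

restrict-pair : (S : Subset n) (c : Fin n → ℕ) {a b : Fin n} → a ≢ b → a ∈ S → b ∈ S →
  (∀ {k} → k ∈ S → k ≡ a ⊎ k ≡ b) → ∀ k → restrict S c k ≡ c a * e a k + c b * e b k
restrict-pair S c {a} {b} a≢b a∈S b∈S S⊆ab k with k ∈? S
... | no k∉S = trans (restrict-∉ S c k∉S) (sym (cong₂ _+_
      (*-e-off (c a) (λ { refl → k∉S a∈S })) (*-e-off (c b) (λ { refl → k∉S b∈S }))))
... | yes k∈S with S⊆ab k∈S
...   | inj₁ refl = trans (restrict-∈ S c k∈S)
      (sym (trans (cong₂ _+_ (*-e-diag (c a) a) (*-e-off (c b) (a≢b ∘ sym))) (+-identityʳ (c a))))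
...   | inj₂ refl = trans (restrict-∈ S c k∈S) (sym (cong₂ _+_ (*-e-off (c a) a≢b) (*-e-diag (c b) b)))

sumOn-pair : (S : Subset n) (c : Fin n → ℕ) {a b : Fin n} → a ≢ b → a ∈ S → b ∈ S →
  (∀ {k} → k ∈ S → k ≡ a ⊎ k ≡ b) → sumOn S c ≡ c a + c b
sumOn-pair S c {a} {b} a≢b a∈S b∈S S⊆ab =
  trans (sumOn≡sum S c) (trans (sum-cong-≗ (restrict-pair S c a≢b a∈S b∈S S⊆ab)) (sum-*e+*e (c a) (c b) a b))

-- Cardinalities of subsets

∣p∪q∣≤∣p∣+∣q∣ : (p q : Subset n) → ∣ p ∪ q ∣ ≤ ∣ p ∣ + ∣ q ∣
∣p∪q∣≤∣p∣+∣q∣ [] [] = z≤n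
∣p∪q∣≤∣p∣+∣q∣ (inside ∷ p) (y ∷ q) = s≤s (≤-trans (∣p∪q∣≤∣p∣+∣q∣ p q) (+-monoʳ-≤ ∣ p ∣ (∣p∣≤∣x∷p∣ y q)))
∣p∪q∣≤∣p∣+∣q∣ (outside ∷ p) (inside ∷ q) = ≤-trans (s≤s (∣p∪q∣≤∣p∣+∣q∣ p q)) (≤-reflexive (sym (+-suc ∣ p ∣ ∣ q ∣)))
∣p∪q∣≤∣p∣+∣q∣ (outside ∷ p) (outside ∷ q) = ∣p∪q∣≤∣p∣+∣q∣ p q

∁q⊆p⇒n∸∣q∣≤∣p∣ : {p q : Subset n} → ∁ q ⊆ p → n ∸ ∣ q ∣ ≤ ∣ p ∣
∁q⊆p⇒n∸∣q∣≤∣p∣ {n} {p} {q} ∁q⊆p = subst (_≤ ∣ p ∣) (∣∁p∣≡n∸∣p∣ q) (p⊆q⇒∣p∣≤∣q∣ ∁q⊆p)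

p⊆∁q⇒∣p∣≤n∸∣q∣ : {p q : Subset n} → p ⊆ ∁ q → ∣ p ∣ ≤ n ∸ ∣ q ∣
p⊆∁q⇒∣p∣≤n∸∣q∣ {n} {p} {q} p⊆∁q = subst (∣ p ∣ ≤_) (∣∁p∣≡n∸∣p∣ q) (p⊆q⇒∣p∣≤∣q∣ p⊆∁q)

∁q⊆p⁺ : {p q : Subset n} → (∀ {x} → x ∉ p → x ∈ q) → ∁ q ⊆ p
∁q⊆p⁺ {p = p} ∉p⇒∈q {x} x∈∁q with x ∈? p
... | yes x∈p = x∈p
... | no x∉p = contradiction (∉p⇒∈q x∉p) (x∈∁p⇒x∉p x∈∁q)

p⊆∁q⁺ : {p q : Subset n} → (∀ {x} → x ∈ q → x ∉ p) → p ⊆ ∁ q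
p⊆∁q⁺ ∈q⇒∉p x∈p = x∉p⇒x∈∁p (λ x∈q → ∈q⇒∉p x∈q x∈p)

∣⁅a⁆∪⁅b⁆∣≤2 : (a b : Fin n) → ∣ ⁅ a ⁆ ∪ ⁅ b ⁆ ∣ ≤ 2
∣⁅a⁆∪⁅b⁆∣≤2 a b = ≤-trans (∣p∪q∣≤∣p∣+∣q∣ ⁅ a ⁆ ⁅ b ⁆) (≤-reflexive (cong₂ _+_ (∣⁅x⁆∣≡1 a) (∣⁅x⁆∣≡1 b)))

2≤∣⁅a⁆∪⁅b⁆∣ : {a b : Fin n} → a ≢ b → 2 ≤ ∣ ⁅ a ⁆ ∪ ⁅ b ⁆ ∣
2≤∣⁅a⁆∪⁅b⁆∣ {a = a} {b} a≢b = subst (_< ∣ ⁅ a ⁆ ∪ ⁅ b ⁆ ∣) (∣⁅x⁆∣≡1 a) (p⊂q⇒∣p∣<∣q∣ ⁅a⁆⊂⁅a⁆∪⁅b⁆)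
  where
  ⁅a⁆⊂⁅a⁆∪⁅b⁆ : ⁅ a ⁆ ⊂ ⁅ a ⁆ ∪ ⁅ b ⁆
  ⁅a⁆⊂⁅a⁆∪⁅b⁆ = p⊆p∪q ⁅ b ⁆ , b , x∈p∪q⁺ (inj₂ (x∈⁅x⁆ b)) , λ b∈⁅a⁆ → a≢b (sym (x∈⁅y⁆⇒x≡y a b∈⁅a⁆))

∈⁅a⁆∪⁅b⁆⁻ : {a b x : Fin n} → x ∈ ⁅ a ⁆ ∪ ⁅ b ⁆ → x ≡ a ⊎ x ≡ b
∈⁅a⁆∪⁅b⁆⁻ {a = a} {b} x∈ with x∈p∪q⁻ ⁅ a ⁆ ⁅ b ⁆ x∈
... | inj₁ x∈⁅a⁆ = inj₁ (x∈⁅y⁆⇒x≡y a x∈⁅a⁆)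
... | inj₂ x∈⁅b⁆ = inj₂ (x∈⁅y⁆⇒x≡y b x∈⁅b⁆)

∈⁅a⁆∪⁅b⁆⁺ : {a b x : Fin n} → x ≡ a ⊎ x ≡ b → x ∈ ⁅ a ⁆ ∪ ⁅ b ⁆
∈⁅a⁆∪⁅b⁆⁺ (inj₁ refl) = x∈p∪q⁺ (inj₁ (x∈⁅x⁆ _))
∈⁅a⁆∪⁅b⁆⁺ (inj₂ refl) = x∈p∪q⁺ (inj₂ (x∈⁅x⁆ _))

n≤∣p∣ : {p : Subset n} → (∀ x → x ∈ p) → n ≤ ∣ p ∣
n≤∣p∣ {n} {p} all∈p = subst (_≤ ∣ p ∣) (∣⊤∣≡n n) (p⊆q⇒∣p∣≤∣q∣ {p = ⊤} (λ {x} _ → all∈p x))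

n∸1≤∣p∣ : {p : Subset n} {a : Fin n} → (∀ {x} → x ∉ p → x ≡ a) → n ∸ 1 ≤ ∣ p ∣
n∸1≤∣p∣ {n} {p} {a} ∉p⇒≡a = subst (λ k → n ∸ k ≤ ∣ p ∣) (∣⁅x⁆∣≡1 a)
  (∁q⊆p⇒n∸∣q∣≤∣p∣ (∁q⊆p⁺ (λ x∉p → subst (_∈ ⁅ a ⁆) (sym (∉p⇒≡a x∉p)) (x∈⁅x⁆ a))))

n∸2≤∣p∣ : {p : Subset n} {a b : Fin n} → (∀ {x} → x ∉ p → x ≡ a ⊎ x ≡ b) → n ∸ 2 ≤ ∣ p ∣
n∸2≤∣p∣ {n} {p} {a} {b} ∉p⇒≡a⊎≡b =
  ≤-trans (∸-monoʳ-≤ n (∣⁅a⁆∪⁅b⁆∣≤2 a b)) (∁q⊆p⇒n∸∣q∣≤∣p∣ (∁q⊆p⁺ (∈⁅a⁆∪⁅b⁆⁺ ∘ ∉p⇒≡a⊎≡b)))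

∣p∣≤n∸1 : {p : Subset n} {a : Fin n} → a ∉ p → ∣ p ∣ ≤ n ∸ 1
∣p∣≤n∸1 {n} {p} {a} a∉p = subst (λ k → ∣ p ∣ ≤ n ∸ k) (∣⁅x⁆∣≡1 a)
  (p⊆∁q⇒∣p∣≤n∸∣q∣ (p⊆∁q⁺ (λ x∈⁅a⁆ → subst (_∉ p) (sym (x∈⁅y⁆⇒x≡y a x∈⁅a⁆)) a∉p)))

∣p∣≤n∸2 : {p : Subset n} {a b : Fin n} → a ≢ b → a ∉ p → b ∉ p → ∣ p ∣ ≤ n ∸ 2
∣p∣≤n∸2 {n} {p} {a} {b} a≢b a∉p b∉p =
  ≤-trans (p⊆∁q⇒∣p∣≤n∸∣q∣ {q = ⁅ a ⁆ ∪ ⁅ b ⁆} (p⊆∁q⁺ (λ x∈ → [ (λ { refl → a∉p }) , (λ { refl → b∉p }) ]′ (∈⁅a⁆∪⁅b⁆⁻ x∈))))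
          (∸-monoʳ-≤ n (2≤∣⁅a⁆∪⁅b⁆∣ a≢b))

-- Neighbourhoods in D(H) and draconian sequences

∈⇒T-lookup : {p : Subset n} {x : Fin n} → x ∈ p → T (lookup p x)
∈⇒T-lookup x∈p = subst T (sym ([]=⇒lookup x∈p)) _

T-lookup⇒∈ : {p : Subset n} {x : Fin n} → T (lookup p x) → x ∈ p
T-lookup⇒∈ {p = p} {x} t = lookup⇒[]= x p (Equivalence.to T-≡ t)

∈-⋃⁺ : {ps : List (Subset n)} {p : Subset n} {x : Fin n} → p ∈ₗ ps → x ∈ p → x ∈ ⋃ ps
∈-⋃⁺ {ps = p ∷ ps} (here refl) x∈p = x∈p∪q⁺ (inj₁ x∈p)
∈-⋃⁺ {ps = q ∷ ps} (there p∈ps) x∈p = x∈p∪q⁺ (inj₂ (∈-⋃⁺ p∈ps x∈p))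

∈-⋃⁻ : (ps : List (Subset n)) {x : Fin n} → x ∈ ⋃ ps → ∃[ p ] p ∈ₗ ps × x ∈ p
∈-⋃⁻ [] x∈⊥ = contradiction x∈⊥ ∉⊥
∈-⋃⁻ (p ∷ ps) x∈ with x∈p∪q⁻ p (⋃ ps) x∈
... | inj₁ x∈p = p , here refl , x∈p
... | inj₂ x∈⋃ps with ∈-⋃⁻ ps x∈⋃ps
...   | q , q∈ps , x∈q = q , there q∈ps , x∈q

∈-nbrUnionD⁺ : (H : Graph n) {S : Subset n} {i k : Fin n} → i ∈ S → k ∈ nbrD H i → k ∈ nbrUnionD H S
∈-nbrUnionD⁺ H {S} {i} i∈S =
  ∈-⋃⁺ (∈-map⁺ (nbrD H) (∈-filter⁺ (T? ∘ lookup S) (∈-allFin i) (∈⇒T-lookup i∈S)))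

∈-nbrUnionD⁻ : (H : Graph n) {S : Subset n} {k : Fin n} → k ∈ nbrUnionD H S → ∃[ i ] i ∈ S × k ∈ nbrD H i
∈-nbrUnionD⁻ {n} H {S} k∈U with ∈-⋃⁻ (L.map (nbrD H) (filterᵇ (lookup S) (allFin n))) k∈U
... | p , p∈ , k∈p with ∈-map⁻ (nbrD H) p∈
...   | i , i∈ , refl = i , T-lookup⇒∈ (proj₂ (∈-filter⁻ (T? ∘ lookup S) {xs = allFin n} i∈)) , k∈p

lookup-nbrD : (H : Graph n) (i k : Fin n) → lookup (nbrD H i) k ≡ ⌊ i F.≟ k ⌋ ∨ H i k
lookup-nbrD H i k = lookup∘tabulate (λ j → ⌊ i F.≟ j ⌋ ∨ H i j) k

removeEdges : Graph n → Graph n → Graph n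
removeEdges H G x y = H x y ∧ not (G x y)

∈-nbrD-K : (i k : Fin n) → k ∈ nbrD (K n) i
∈-nbrD-K {n} i k = lookup⇒[]= k (nbrD (K n) i) (trans (lookup-nbrD (K n) i k) (∨-inverseʳ ⌊ i F.≟ k ⌋))

∉-nbrD-K∖ : (G : Graph n) {i k : Fin n} → i ≢ k → T (G i k) → k ∉ nbrD (removeEdges (K n) G) i
∉-nbrD-K∖ {n} G {i} {k} i≢k Gik k∈ = contradiction (trans (sym ([]=⇒lookup k∈)) removed) λ ()
  where
  removed : lookup (nbrD (removeEdges (K n) G) i) k ≡ false
  removed rewrite lookup-nbrD (removeEdges (K n) G) i k | dec-no (i F.≟ k) i≢k | Equivalence.to T-≡ Gik = refl

∉-nbrD-K∖⇒T : (G : Graph n) {i k : Fin n} → k ∉ nbrD (removeEdges (K n) G) i → T (G i k)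
∉-nbrD-K∖⇒T {n} G {i} {k} k∉ with G i k in Gik
... | true = _
... | false = contradiction (lookup⇒[]= k _ kept) k∉
  where
  kept : lookup (nbrD (removeEdges (K n) G) i) k ≡ true
  kept rewrite lookup-nbrD (removeEdges (K n) G) i k | Gik | ∧-identityʳ (not ⌊ i F.≟ k ⌋) = ∨-inverseʳ ⌊ i F.≟ k ⌋

nbrUnionD-K-full : {S : Subset n} → Nonempty S → ∀ k → k ∈ nbrUnionD (K n) S
nbrUnionD-K-full (i , i∈S) k = ∈-nbrUnionD⁺ (K _) i∈S (∈-nbrD-K i k)

∉-nbrUnionD-K∖ : (G : Graph n) {S : Subset n} {w : Fin n} →
  (∀ {i} → i ∈ S → i ≢ w × T (G i w)) → w ∉ nbrUnionD (removeEdges (K n) G) S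
∉-nbrUnionD-K∖ G adjacent w∈U with ∈-nbrUnionD⁻ _ w∈U
... | i , i∈S , w∈N = ∉-nbrD-K∖ G (proj₁ (adjacent i∈S)) (proj₂ (adjacent i∈S)) w∈N

∉-nbrUnionD-K∖⇒T : (G : Graph n) {S : Subset n} {i w : Fin n} →
  w ∉ nbrUnionD (removeEdges (K n) G) S → i ∈ S → T (G i w)
∉-nbrUnionD-K∖⇒T G w∉U i∈S = ∉-nbrD-K∖⇒T G (w∉U ∘ ∈-nbrUnionD⁺ _ i∈S)

Violating : Graph n → (Fin n → ℕ) → Subset n → Set
Violating H c S = Nonempty S × ∣ nbrUnionD H S ∣ ≤ sumOn S c

violating⇒¬draconian : {H : Graph n} {c : Fin n → ℕ} {S : Subset n} → Violating H c S → ¬ Draconian H c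
violating⇒¬draconian (S≢∅ , ∣U∣≤ΣSc) (_ , strict) = <-irrefl refl (<-≤-trans (strict _ S≢∅) ∣U∣≤ΣSc)

¬draconian⇒violating : {H : Graph n} {c : Fin n → ℕ} → sumF c ≡ n ∸ 1 → ¬ Draconian H c →
  ∃[ S ] Violating H c S
¬draconian⇒violating {H = H} {c} Σc ¬draconian
  with anySubset? (λ S → nonempty? S ×-dec (∣ nbrUnionD H S ∣ ≤? sumOn S c))
... | yes violating = violating
... | no ¬violating = contradiction (Σc , λ S S≢∅ → ≰⇒> (λ ∣U∣≤ΣSc → ¬violating (S , S≢∅ , ∣U∣≤ΣSc))) ¬draconian

sumOn<n : .{{_ : NonZero n}} {c : Fin n → ℕ} (S : Subset n) → sumF c ≡ n ∸ 1 → sumOn S c < n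
sumOn<n {n} {c} S Σc = begin-strict
  sumOn S c     ≤⟨ sumOn≤sumF S c ⟩
  sumF c        ≡⟨ Σc ⟩
  n ∸ 1         <⟨ m≤pred[n]⇒suc[m]≤n ≤-refl ⟩
  n             ∎
  where open ≤-Reasoning

draconian-K : .{{_ : NonZero n}} {c : Fin n → ℕ} → sumF c ≡ n ∸ 1 → Draconian (K n) c
draconian-K Σc = Σc , λ S S≢∅ → <-≤-trans (sumOn<n S Σc) (n≤∣p∣ (nbrUnionD-K-full S≢∅))

violating⇒missing : .{{_ : NonZero n}} {H : Graph n} {c : Fin n → ℕ} {S : Subset n} →
  sumF c ≡ n ∸ 1 → Violating H c S → ∃[ w ] w ∉ nbrUnionD H S
violating⇒missing {n} {H} {c} {S} Σc (_ , ∣U∣≤ΣSc) =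
  ¬∀⟶∃¬ n (_∈ nbrUnionD H S) (_∈? nbrUnionD H S) λ all∈U →
    <⇒≱ (sumOn<n S Σc) (≤-trans (n≤∣p∣ all∈U) ∣U∣≤ΣSc)

-- Natural-number arithmetic

m∸n≡1+m∸[1+n] : ∀ {m n} → n < m → m ∸ n ≡ suc (m ∸ suc n)
m∸n≡1+m∸[1+n] {suc m} (s≤s n≤m) = +-∸-assoc 1 n≤m

[m%n+k]%n≡[m+k]%n : ∀ m k n .{{_ : NonZero n}} → (m % n + k) % n ≡ (m + k) % n
[m%n+k]%n≡[m+k]%n m k n = begin
  (m % n + k) % n            ≡⟨ %-distribˡ-+ (m % n) k n ⟩
  (m % n % n + k % n) % n    ≡⟨ cong (λ a → (a + k % n) % n) (m%n%n≡m%n m n) ⟩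
  (m % n + k % n) % n        ≡⟨ %-distribˡ-+ m k n ⟨
  (m + k) % n                ∎
  where open ≡-Reasoning

[m+k]%n≢m%n : ∀ m {k n} .{{_ : NonZero n}} → 0 < k → k < n → (m + k) % n ≢ m % n
[m+k]%n≢m%n m {k} {n} 0<k k<n [m+k]%n≡m%n with m % n + k <? n
... | yes a+k<n = <-irrefl (sym (trans (sym (m<n⇒m%n≡m a+k<n)) [a+k]%n≡a)) (m<m+n a 0<k)
  where
  a = m % n
  [a+k]%n≡a : (a + k) % n ≡ a
  [a+k]%n≡a = trans ([m%n+k]%n≡[m+k]%n m k n) [m+k]%n≡m%n
... | no a+k≮n = <-irrefl (+-cancelˡ-≡ a k n a+k≡a+n) k<n
  where
  a = m % n
  n≤a+k = ≮⇒≥ a+k≮n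
  a+k∸n≡a : a + k ∸ n ≡ a
  a+k∸n≡a = begin
    a + k ∸ n            ≡⟨ m<n⇒m%n≡m (m<n+o⇒m∸n<o (a + k) n (+-mono-< (m%n<n m n) k<n)) ⟨
    (a + k ∸ n) % n      ≡⟨ m≤n⇒[n∸m]%m≡n%m n≤a+k ⟩
    (a + k) % n          ≡⟨ [m%n+k]%n≡[m+k]%n m k n ⟩
    (m + k) % n          ≡⟨ [m+k]%n≡m%n ⟩
    a                    ∎
    where open ≡-Reasoning
  a+k≡a+n : a + k ≡ a + n
  a+k≡a+n = trans (sym (m∸n+n≡m n≤a+k)) (cong (_+ n) a+k∸n≡a)

-- The cycle C_M°

module Cycle {N M : ℕ} .{{_ : NonZero M}} (3≤M : 3 ≤ M) (v : Fin M → Fin N) (v-injective : Injective _≡_ _≡_ v) where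

  -- Indices of the vᵢ are natural numbers read modulo M; the predecessor of x is x + (M ∸ 1).
  vm : ℕ → Fin N
  vm = vmod M v

  private
    2≤M : 2 ≤ M
    2≤M = ≤-trans (s≤s (s≤s z≤n)) 3≤M

    toℕ-mod : ∀ x → toℕ (x mod M) ≡ x % M
    toℕ-mod x = Finₚ.toℕ-fromℕ< (m%n<n x M)

  vm-cong : ∀ {x y} → x % M ≡ y % M → vm x ≡ vm y
  vm-cong {x} {y} eq = cong v (Finₚ.toℕ-injective (trans (toℕ-mod x) (trans eq (sym (toℕ-mod y)))))

  vm-injective : ∀ {x y} → vm x ≡ vm y → x % M ≡ y % M
  vm-injective {x} {y} eq = trans (sym (toℕ-mod x)) (trans (cong toℕ (v-injective eq)) (toℕ-mod y))

  vm-toℕ : (i : Fin M) → vm (toℕ i) ≡ v i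
  vm-toℕ i = cong v (Finₚ.toℕ-injective (trans (toℕ-mod (toℕ i)) (m<n⇒m%n≡m (Finₚ.toℕ<n i))))

  vm-toℕ-mod+ : ∀ x k → vm (toℕ (x mod M) + k) ≡ vm (x + k)
  vm-toℕ-mod+ x k = vm-cong (trans (cong (λ a → (a + k) % M) (toℕ-mod x)) ([m%n+k]%n≡[m+k]%n x k M))

  vm-+M : ∀ x → vm (x + M) ≡ vm x
  vm-+M x = vm-cong ([m+n]%n≡m%n x M)

  vm-pred+suc : ∀ x k → vm (x + (M ∸ 1) + suc k) ≡ vm (x + k)
  vm-pred+suc x k = trans (cong vm x+[M∸1]+[1+k]≡x+k+M) (vm-+M (x + k))
    where
    x+[M∸1]+[1+k]≡x+k+M : x + (M ∸ 1) + suc k ≡ x + k + M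
    x+[M∸1]+[1+k]≡x+k+M = begin
      x + (M ∸ 1) + suc k     ≡⟨ +-assoc x (M ∸ 1) (suc k) ⟩
      x + (M ∸ 1 + suc k)     ≡⟨ cong (x +_) (+-suc (M ∸ 1) k) ⟩
      x + (suc (M ∸ 1) + k)   ≡⟨ cong (λ m → x + (m + k)) (suc-pred M) ⟩
      x + (M + k)             ≡⟨ cong (x +_) (+-comm M k) ⟩
      x + (k + M)             ≡⟨ +-assoc x k M ⟨
      x + k + M               ∎
      where open ≡-Reasoning

  vm-shift-≢ : ∀ x {k} → 0 < k → k < M → vm x ≢ vm (x + k)
  vm-shift-≢ x 0<k k<M eq = [m+k]%n≢m%n x 0<k k<M (sym (vm-injective eq))

  vm≢vm+1 : ∀ x → vm x ≢ vm (x + 1)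
  vm≢vm+1 x = vm-shift-≢ x (s≤s z≤n) 2≤M

  vm≢vm+2 : ∀ x → vm x ≢ vm (x + 2)
  vm≢vm+2 x = vm-shift-≢ x (s≤s z≤n) 3≤M

  vm≢vm-pred : ∀ x → vm x ≢ vm (x + (M ∸ 1))
  vm≢vm-pred x = vm-shift-≢ x (m<n⇒0<n∸m 2≤M) (∸-monoʳ-< {o = 0} (s≤s z≤n) (≤-trans (s≤s z≤n) 3≤M))

  vm+1≢vm-pred : ∀ x → vm (x + 1) ≢ vm (x + (M ∸ 1))
  vm+1≢vm-pred x eq =
    vm-shift-≢ (x + 1) (m<n⇒0<n∸m 3≤M) (∸-monoʳ-< {o = 0} (s≤s z≤n) 2≤M) (trans eq (cong vm x+[M∸1]≡x+1+[M∸2]))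
    where
    x+[M∸1]≡x+1+[M∸2] : x + (M ∸ 1) ≡ x + 1 + (M ∸ 2)
    x+[M∸1]≡x+1+[M∸2] = trans (cong (x +_) (+-∸-assoc 1 2≤M)) (sym (+-assoc x 1 (M ∸ 2)))

  vm+1≢vm+3 : ∀ x → vm (x + 1) ≢ vm (x + 3)
  vm+1≢vm+3 x eq = vm≢vm+2 (x + 1) (trans eq (cong vm (sym (+-assoc x 1 2))))

  vm+2≢vm+1 : ∀ x → vm (x + 2) ≢ vm (x + 1)
  vm+2≢vm+1 x eq = vm≢vm+1 (x + 1) (trans (sym eq) (cong vm (sym (+-assoc x 1 1))))

  vm+2≢vm+3 : ∀ x → vm (x + 2) ≢ vm (x + 3)
  vm+2≢vm+3 x eq = vm≢vm+1 (x + 2) (trans eq (cong vm (sym (+-assoc x 2 1))))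

  vm-pred≡vm+3⇒M≡4 : ∀ x → vm (x + (M ∸ 1)) ≡ vm (x + 3) → M ≡ 4
  vm-pred≡vm+3⇒M≡4 x eq with M ℕ.≟ 4 | M ℕ.≟ 3
  ... | yes M≡4 | _ = M≡4
  ... | no _ | yes M≡3 = contradiction (begin
    vm (x + 2)           ≡⟨ cong (λ m → vm (x + (m ∸ 1))) M≡3 ⟨
    vm (x + (M ∸ 1))     ≡⟨ eq ⟩
    vm (x + 3)           ≡⟨ cong vm (+-assoc x 2 1) ⟨
    vm (x + 2 + 1)       ∎) (vm≢vm+1 (x + 2))
    where open ≡-Reasoning
  ... | no M≢4 | no M≢3 = contradiction (trans (sym eq) (cong vm x+[M∸1]≡x+3+[M∸4]))
                            (vm-shift-≢ (x + 3) (m<n⇒0<n∸m 4<M) (∸-monoʳ-< {o = 0} (s≤s z≤n) (<⇒≤ 4<M)))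
    where
    4<M : 4 < M
    4<M = ≤∧≢⇒< (≤∧≢⇒< 3≤M (M≢3 ∘ sym)) (M≢4 ∘ sym)
    x+[M∸1]≡x+3+[M∸4] : x + (M ∸ 1) ≡ x + 3 + (M ∸ 4)
    x+[M∸1]≡x+3+[M∸4] = trans (cong (x +_) (+-∸-assoc 3 (<⇒≤ 4<M))) (sym (+-assoc x 3 (M ∸ 4)))

  Consecutive : Fin M → Fin M → Set
  Consecutive a b = suc (toℕ a) % M ≡ toℕ b ⊎ suc (toℕ b) % M ≡ toℕ a

  private
    edgeAt : Fin N → Fin N → Fin M → Fin M → Bool
    edgeAt x y a b = ⌊ v a F.≟ x ⌋ ∧ ⌊ v b F.≟ y ⌋ ∧
                     (⌊ suc (toℕ a) % M ℕ.≟ toℕ b ⌋ ∨ ⌊ suc (toℕ b) % M ℕ.≟ toℕ a ⌋)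

    edgeAt⁺ : ∀ {x y} a b → v a ≡ x → v b ≡ y → Consecutive a b → T (edgeAt x y a b)
    edgeAt⁺ {x} {y} a b va vb a~b
      with v a F.≟ x | v b F.≟ y | suc (toℕ a) % M ℕ.≟ toℕ b | suc (toℕ b) % M ℕ.≟ toℕ a
    ... | no ¬va | _      | _      | _      = contradiction va ¬va
    ... | yes _  | no ¬vb | _      | _      = contradiction vb ¬vb
    ... | yes _  | yes _  | yes _  | _      = _
    ... | yes _  | yes _  | no _   | yes _  = _
    ... | yes _  | yes _  | no ¬ab | no ¬ba = contradiction a~b [ ¬ab , ¬ba ]′

    edgeAt⁻ : ∀ {x y} a b → T (edgeAt x y a b) → v a ≡ x × v b ≡ y × Consecutive a b
    edgeAt⁻ {x} {y} a b t
      with v a F.≟ x | v b F.≟ y | suc (toℕ a) % M ℕ.≟ toℕ b | suc (toℕ b) % M ℕ.≟ toℕ a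
    ... | yes va | yes vb | yes ab | _      = va , vb , inj₁ ab
    ... | yes va | yes vb | no _   | yes ba = va , vb , inj₂ ba

  -- Kept opaque: letting Agda unfold cycleEdge while elaborating adjacency facts is extremely slow.
  infix 4 _~_
  opaque
    _~_ : Fin N → Fin N → Set
    x ~ y = T (cycleEdge M v x y)

  opaque
    unfolding _~_

    T⇒~ : ∀ {x y} → T (cycleEdge M v x y) → x ~ y
    T⇒~ t = t

    ~⇒T : ∀ {x y} → x ~ y → T (cycleEdge M v x y)
    ~⇒T x~y = x~y

    ~⁺ : ∀ {x y} (a b : Fin M) → v a ≡ x → v b ≡ y → Consecutive a b → x ~ y
    ~⁺ {x} {y} a b va vb a~b =
      any⁺ (λ a → any (edgeAt x y a) (allFin M)) (lose (∈-allFin a)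
        (any⁺ (edgeAt x y a) (lose (∈-allFin b) (edgeAt⁺ a b va vb a~b))))

    ~⁻ : ∀ {x y} → x ~ y → ∃₂ λ a b → v a ≡ x × v b ≡ y × Consecutive a b
    ~⁻ {x} {y} x~y with satisfied (any⁻ (λ a → any (edgeAt x y a) (allFin M)) (allFin M) x~y)
    ... | a , t with satisfied (any⁻ (edgeAt x y a) (allFin M) t)
    ... | b , t′ = a , b , edgeAt⁻ a b t′

  ~-sym : ∀ {x y} → x ~ y → y ~ x
  ~-sym x~y = let a , b , va , vb , a~b = ~⁻ x~y in ~⁺ b a vb va (swap a~b)

  ~⇒vm : ∀ {y w} → y ~ w → ∃[ x ] w ≡ vm x
  ~⇒vm y~w = let _ , b , _ , vb , _ = ~⁻ y~w in toℕ b , trans (sym vb) (sym (vm-toℕ b))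

  vm~vm+1 : ∀ x → vm x ~ vm (x + 1)
  vm~vm+1 x = ~⁺ (x mod M) ((x + 1) mod M) refl refl (inj₁ (begin
    suc (toℕ (x mod M)) % M    ≡⟨ cong (λ a → suc a % M) (toℕ-mod x) ⟩
    suc (x % M) % M            ≡⟨ cong (_% M) (+-comm 1 (x % M)) ⟩
    (x % M + 1) % M            ≡⟨ [m%n+k]%n≡[m+k]%n x 1 M ⟩
    (x + 1) % M                ≡⟨ toℕ-mod (x + 1) ⟨
    toℕ ((x + 1) mod M)        ∎))
    where open ≡-Reasoning

  vm~vm-pred : ∀ x → vm x ~ vm (x + (M ∸ 1))
  vm~vm-pred x = ~-sym (subst (vm (x + (M ∸ 1)) ~_) (trans (vm-pred+suc x 0) (cong vm (+-identityʳ x)))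
                             (vm~vm+1 (x + (M ∸ 1))))

  vm+2~vm+1 : ∀ x → vm (x + 2) ~ vm (x + 1)
  vm+2~vm+1 x = ~-sym (subst (λ y → vm (x + 1) ~ vm y) (+-assoc x 1 1) (vm~vm+1 (x + 1)))

  vm+2~vm+3 : ∀ x → vm (x + 2) ~ vm (x + 3)
  vm+2~vm+3 x = subst (λ y → vm (x + 2) ~ vm y) (+-assoc x 2 1) (vm~vm+1 (x + 2))

  ~-neighbours : ∀ x {y} → vm x ~ y → y ≡ vm (x + 1) ⊎ y ≡ vm (x + (M ∸ 1))
  ~-neighbours x {y} x~y = neighbours (~⁻ x~y)
    where
    neighbours : ∃₂ (λ a b → v a ≡ vm x × v b ≡ y × Consecutive a b) → y ≡ vm (x + 1) ⊎ y ≡ vm (x + (M ∸ 1))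
    neighbours (a , b , va , vb , a~b) with v-injective va
    ... | refl with a~b
    ...   | inj₁ a→b = inj₁ (begin
      y                          ≡⟨ sym vb ⟩
      v b                        ≡⟨ sym (vm-toℕ b) ⟩
      vm (toℕ b)                 ≡⟨ cong vm a→b ⟨
      vm (suc (toℕ a) % M)       ≡⟨ vm-cong (m%n%n≡m%n (suc (toℕ a)) M) ⟩
      vm (suc (toℕ a))           ≡⟨ cong vm (+-comm 1 (toℕ a)) ⟩
      vm (toℕ a + 1)             ≡⟨ vm-toℕ-mod+ x 1 ⟩
      vm (x + 1)                 ∎)
      where open ≡-Reasoning
    ...   | inj₂ b→a = inj₂ (begin
      y                            ≡⟨ sym vb ⟩
      v b                          ≡⟨ sym (vm-toℕ b) ⟩
      vm (toℕ b)                   ≡⟨ vm-+M (toℕ b) ⟨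
      vm (toℕ b + M)               ≡⟨ cong (λ k → vm (toℕ b + k)) (suc-pred M) ⟨
      vm (toℕ b + suc (M ∸ 1))     ≡⟨ cong vm (+-suc (toℕ b) (M ∸ 1)) ⟩
      vm (suc (toℕ b) + (M ∸ 1))   ≡⟨ vm-cong ([m%n+k]%n≡[m+k]%n (suc (toℕ b)) (M ∸ 1) M) ⟨
      vm (suc (toℕ b) % M + (M ∸ 1)) ≡⟨ cong (λ k → vm (k + (M ∸ 1))) b→a ⟩
      vm (toℕ a + (M ∸ 1))         ≡⟨ vm-toℕ-mod+ x (M ∸ 1) ⟩
      vm (x + (M ∸ 1))             ∎)
      where open ≡-Reasoning

  common-neighbour : ∀ i {w} → vm i ~ w → vm (i + 2) ~ w → w ≡ vm (i + 1) ⊎ (M ≡ 4 × w ≡ vm (i + 3))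
  common-neighbour i {w} p~w q~w = combine (~-neighbours i p~w) (~-neighbours (i + 2) q~w)
    where
    combine : w ≡ vm (i + 1) ⊎ w ≡ vm (i + (M ∸ 1)) → w ≡ vm (i + 2 + 1) ⊎ w ≡ vm (i + 2 + (M ∸ 1)) →
              w ≡ vm (i + 1) ⊎ (M ≡ 4 × w ≡ vm (i + 3))
    combine (inj₁ w≡vm[i+1]) _ = inj₁ w≡vm[i+1]
    combine (inj₂ w≡vm[i-1]) (inj₁ w≡vm[i+2+1]) =
      inj₂ (vm-pred≡vm+3⇒M≡4 i (trans (sym w≡vm[i-1]) w≡vm[i+3]) , w≡vm[i+3])
      where
      w≡vm[i+3] = trans w≡vm[i+2+1] (cong vm (+-assoc i 2 1))
    combine (inj₂ _) (inj₂ w≡vm[i+2-1]) =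
      inj₁ (trans w≡vm[i+2-1] (trans (cong vm i+2+[M∸1]≡i+[M∸1]+2) (vm-pred+suc i 1)))
      where
      i+2+[M∸1]≡i+[M∸1]+2 : i + 2 + (M ∸ 1) ≡ i + (M ∸ 1) + 2
      i+2+[M∸1]≡i+[M∸1]+2 = trans (+-assoc i 2 (M ∸ 1)) (trans (cong (i +_) (+-comm 2 (M ∸ 1))) (sym (+-assoc i (M ∸ 1) 2)))

  common-neighbour-≢4 : M ≢ 4 → ∀ i {w} → vm i ~ w → vm (i + 2) ~ w → w ≡ vm (i + 1)
  common-neighbour-≢4 M≢4 i p~w q~w with common-neighbour i p~w q~w
  ... | inj₁ w≡vm[i+1] = w≡vm[i+1]
  ... | inj₂ (M≡4 , _) = contradiction M≡4 M≢4

-- The classification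

module Classification {N M : ℕ} .{{_ : NonZero M}} (5≤N : 5 ≤ N) (3≤M : 3 ≤ M)
                      (v : Fin M → Fin N) (v-injective : Injective _≡_ _≡_ v) where

  private
    N∸1≡1+[N∸2] : N ∸ 1 ≡ suc (N ∸ 2)
    N∸1≡1+[N∸2] = m∸n≡1+m∸[1+n] (≤-trans (s≤s (s≤s z≤n)) 5≤N)

    N∸2≡1+[N∸3] : N ∸ 2 ≡ suc (N ∸ 3)
    N∸2≡1+[N∸3] = m∸n≡1+m∸[1+n] (≤-trans (s≤s (s≤s (s≤s z≤n))) 5≤N)

    N∸2+1≡N∸1 : N ∸ 2 + 1 ≡ N ∸ 1
    N∸2+1≡N∸1 = trans (+-comm (N ∸ 2) 1) (sym N∸1≡1+[N∸2])

    N∸3<N∸2 : N ∸ 3 < N ∸ 2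
    N∸3<N∸2 = ≤-reflexive (sym N∸2≡1+[N∸3])

    1≤N∸3 : 1 ≤ N ∸ 3
    1≤N∸3 = m+n≤o⇒m≤o∸n 1 (≤-trans (s≤s (s≤s (s≤s (s≤s z≤n)))) 5≤N)

    N∸1≡2+[N∸3] : N ∸ 1 ≡ 2 + (N ∸ 3)
    N∸1≡2+[N∸3] = trans N∸1≡1+[N∸2] (cong suc N∸2≡1+[N∸3])

    ≰N∸2⇒≤N∸3 : ∀ {y} → ¬ (N ∸ 2 ≤ y) → y ≤ N ∸ 3
    ≰N∸2⇒≤N∸3 {y} N∸2≰y = ≤-pred (subst (suc y ≤_) N∸2≡1+[N∸3] (≰⇒> N∸2≰y))

    instance
      N-nonZero : NonZero N
      N-nonZero = >-nonZero (≤-trans (s≤s z≤n) 5≤N)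

  open Cycle 3≤M v v-injective

  -- Definitionally removeEdges (K N) (cycleEdge M v), so the lemmas about removeEdges apply.
  K∖C : Graph N
  K∖C = KminusCycle N M v

  ∉U⇒~ : ∀ {S} {i w : Fin N} → w ∉ nbrUnionD K∖C S → i ∈ S → i ~ w
  ∉U⇒~ w∉U i∈S = T⇒~ (∉-nbrUnionD-K∖⇒T (cycleEdge M v) w∉U i∈S)

  ∉-nbrUnionD-⁅⁆ : ∀ {p w : Fin N} → p ≢ w → p ~ w → w ∉ nbrUnionD K∖C ⁅ p ⁆
  ∉-nbrUnionD-⁅⁆ {p} {w} p≢w p~w = ∉-nbrUnionD-K∖ (cycleEdge M v) λ i∈⁅p⁆ →
    subst (λ i → i ≢ w × T (cycleEdge M v i w)) (sym (x∈⁅y⁆⇒x≡y p i∈⁅p⁆)) (p≢w , ~⇒T p~w)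

  ∉-nbrUnionD-⁅⁆∪⁅⁆ : ∀ {p q w : Fin N} → p ≢ w → p ~ w → q ≢ w → q ~ w → w ∉ nbrUnionD K∖C (⁅ p ⁆ ∪ ⁅ q ⁆)
  ∉-nbrUnionD-⁅⁆∪⁅⁆ {p} {q} {w} p≢w p~w q≢w q~w = ∉-nbrUnionD-K∖ (cycleEdge M v) {S = ⁅ p ⁆ ∪ ⁅ q ⁆} λ i∈S →
    [ (λ { refl → p≢w , ~⇒T p~w }) , (λ { refl → q≢w , ~⇒T q~w }) ]′ (∈⁅a⁆∪⁅b⁆⁻ i∈S)

  ⁅⁆∪⁅⁆-violating : ∀ {c : Fin N → ℕ} {p q : Fin N} → p ≢ q → ∣ nbrUnionD K∖C (⁅ p ⁆ ∪ ⁅ q ⁆) ∣ ≤ c p + c q → Violating K∖C c (⁅ p ⁆ ∪ ⁅ q ⁆)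
  ⁅⁆∪⁅⁆-violating {c} {p} {q} p≢q ∣U∣≤ = (p , x∈p∪q⁺ (inj₁ (x∈⁅x⁆ p))) ,
    subst (_ ≤_) (sym (sumOn-pair _ c p≢q (x∈p∪q⁺ (inj₁ (x∈⁅x⁆ p))) (x∈p∪q⁺ (inj₂ (x∈⁅x⁆ q))) ∈⁅a⁆∪⁅b⁆⁻)) ∣U∣≤

  sum-X : ∀ {c : Fin N → ℕ} {a j : Fin N} → (∀ k → c k ≡ (N ∸ 2) * e a k + e j k) → sumF c ≡ N ∸ 1
  sum-X {c} {a} {j} c≡ = begin
    sumF c                                       ≡⟨ sumF≡sum c ⟩
    sum c                                        ≡⟨ sum-cong-≗ c≡ ⟩
    sum (λ k → (N ∸ 2) * e a k + e j k)          ≡⟨ ∑-distrib-+ (λ k → (N ∸ 2) * e a k) (e j) ⟩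
    sum (λ k → (N ∸ 2) * e a k) + sum (e j)      ≡⟨ cong₂ _+_ (sum-*e (N ∸ 2) a) (sum-e j) ⟩
    N ∸ 2 + 1                                    ≡⟨ N∸2+1≡N∸1 ⟩
    N ∸ 1                                        ∎
    where open ≡-Reasoning

  N∸2≤c-X : ∀ {c : Fin N → ℕ} {a j : Fin N} → (∀ k → c k ≡ (N ∸ 2) * e a k + e j k) → N ∸ 2 ≤ c a
  N∸2≤c-X {c} {a} {j} c≡ = begin
    N ∸ 2                          ≤⟨ ≤*e (N ∸ 2) a ⟩
    (N ∸ 2) * e a a                ≤⟨ m≤m+n _ (e j a) ⟩
    (N ∸ 2) * e a a + e j a        ≡⟨ c≡ a ⟨
    c a                            ∎
    where open ≤-Reasoning

  ¬draconian-X : ∀ {c : Fin N → ℕ} x (j : Fin N) → (∀ k → c k ≡ (N ∸ 2) * e (vm x) k + e j k) → ¬ Draconian K∖C c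
  ¬draconian-X {c} x j c≡ = violating⇒¬draconian {H = K∖C} ((vm x , x∈⁅x⁆ (vm x)) , (begin
    ∣ nbrUnionD K∖C ⁅ vm x ⁆ ∣   ≤⟨ ∣p∣≤n∸2 (vm+1≢vm-pred x) (∉-nbrUnionD-⁅⁆ (vm≢vm+1 x) (vm~vm+1 x))
                                                        (∉-nbrUnionD-⁅⁆ (vm≢vm-pred x) (vm~vm-pred x)) ⟩
    N ∸ 2                       ≤⟨ N∸2≤c-X c≡ ⟩
    c (vm x)                    ≤⟨ ∈⇒≤sumOn ⁅ vm x ⁆ c (x∈⁅x⁆ (vm x)) ⟩
    sumOn ⁅ vm x ⁆ c            ∎))
    where open ≤-Reasoning

  sum-Y : ∀ {c : Fin N → ℕ} {p q : Fin N} {r} → r ≤ N ∸ 3 →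
    (∀ k → c k ≡ r * e p k + (N ∸ 1 ∸ r) * e q k) → sumF c ≡ N ∸ 1
  sum-Y {c} {p} {q} {r} r≤N∸3 c≡ = begin
    sumF c                                          ≡⟨ sumF≡sum c ⟩
    sum c                                           ≡⟨ sum-cong-≗ c≡ ⟩
    sum (λ k → r * e p k + (N ∸ 1 ∸ r) * e q k)     ≡⟨ sum-*e+*e r (N ∸ 1 ∸ r) p q ⟩
    r + (N ∸ 1 ∸ r)                                 ≡⟨ m+[n∸m]≡n (≤-trans r≤N∸3 (∸-monoʳ-≤ N (s≤s z≤n))) ⟩
    N ∸ 1                                           ∎
    where open ≡-Reasoning

  sum-Z : ∀ {c : Fin N → ℕ} {p q s : Fin N} {r} → r ≤ N ∸ 3 →
    (∀ k → c k ≡ r * e p k + (N ∸ 2 ∸ r) * e q k + e s k) → sumF c ≡ N ∸ 1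
  sum-Z {c} {p} {q} {s} {r} r≤N∸3 c≡ = begin
    sumF c                                                   ≡⟨ sumF≡sum c ⟩
    sum c                                                    ≡⟨ sum-cong-≗ c≡ ⟩
    sum (λ k → r * e p k + (N ∸ 2 ∸ r) * e q k + e s k)      ≡⟨ ∑-distrib-+ (λ k → r * e p k + (N ∸ 2 ∸ r) * e q k) (e s) ⟩
    sum (λ k → r * e p k + (N ∸ 2 ∸ r) * e q k) + sum (e s)  ≡⟨ cong₂ _+_ (sum-*e+*e r (N ∸ 2 ∸ r) p q) (sum-e s) ⟩
    r + (N ∸ 2 ∸ r) + 1                                      ≡⟨ cong (_+ 1) (m+[n∸m]≡n (≤-trans r≤N∸3 (∸-monoʳ-≤ N (s≤s (s≤s z≤n))))) ⟩
    N ∸ 2 + 1                                                ≡⟨ N∸2+1≡N∸1 ⟩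
    N ∸ 1                                                    ∎
    where open ≡-Reasoning

  ¬draconian-Y : ∀ {c : Fin N → ℕ} x {r} → r ≤ N ∸ 3 →
    (∀ k → c k ≡ r * e (vm x) k + (N ∸ 1 ∸ r) * e (vm (x + 2)) k) → ¬ Draconian K∖C c
  ¬draconian-Y {c} x {r} r≤N∸3 c≡ = violating⇒¬draconian {H = K∖C} (⁅⁆∪⁅⁆-violating (vm≢vm+2 x) (begin
    ∣ nbrUnionD K∖C (⁅ p ⁆ ∪ ⁅ q ⁆) ∣  ≤⟨ ∣p∣≤n∸1 (∉-nbrUnionD-⁅⁆∪⁅⁆ (vm≢vm+1 x) (vm~vm+1 x) (vm+2≢vm+1 x) (vm+2~vm+1 x)) ⟩
    N ∸ 1                            ≡⟨ m+[n∸m]≡n (≤-trans r≤N∸3 (∸-monoʳ-≤ N (s≤s z≤n))) ⟨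
    r + t                            ≤⟨ +-mono-≤ (≤*e r p) (≤*e t q) ⟩
    r * e p p + t * e q q            ≤⟨ +-mono-≤ (m≤m+n (r * e p p) (t * e q p)) (m≤n+m (t * e q q) (r * e p q)) ⟩
    (r * e p p + t * e q p) + (r * e p q + t * e q q) ≡⟨ cong₂ _+_ (c≡ p) (c≡ q) ⟨
    c p + c q                        ∎))
    where
    open ≤-Reasoning
    p = vm x
    q = vm (x + 2)
    t = N ∸ 1 ∸ r

  ¬draconian-Z : M ≡ 4 → ∀ {c : Fin N → ℕ} x {r} {s : Fin N} → r ≤ N ∸ 3 →
    (∀ k → c k ≡ r * e (vm x) k + (N ∸ 2 ∸ r) * e (vm (x + 2)) k + e s k) → ¬ Draconian K∖C c
  ¬draconian-Z M≡4 {c} x {r} {s} r≤N∸3 c≡ = violating⇒¬draconian {H = K∖C} (⁅⁆∪⁅⁆-violating (vm≢vm+2 x) (begin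
    ∣ nbrUnionD K∖C (⁅ p ⁆ ∪ ⁅ q ⁆) ∣  ≤⟨ ∣p∣≤n∸2 (vm+1≢vm+3 x)
                                          (∉-nbrUnionD-⁅⁆∪⁅⁆ (vm≢vm+1 x) (vm~vm+1 x) (vm+2≢vm+1 x) (vm+2~vm+1 x))
                                          (∉-nbrUnionD-⁅⁆∪⁅⁆ p≢vm+3 p~vm+3 (vm+2≢vm+3 x) (vm+2~vm+3 x)) ⟩
    N ∸ 2                            ≡⟨ m+[n∸m]≡n (≤-trans r≤N∸3 (∸-monoʳ-≤ N (s≤s (s≤s z≤n)))) ⟨
    r + t                            ≤⟨ +-mono-≤ (≤*e r p) (≤*e t q) ⟩
    r * e p p + t * e q q            ≤⟨ +-mono-≤ (≤-trans (m≤m+n (r * e p p) (t * e q p)) (m≤m+n _ (e s p)))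
                                           (≤-trans (m≤n+m (t * e q q) (r * e p q)) (m≤m+n _ (e s q))) ⟩
    (r * e p p + t * e q p + e s p) + (r * e p q + t * e q q + e s q) ≡⟨ cong₂ _+_ (c≡ p) (c≡ q) ⟨
    c p + c q                        ∎))
    where
    open ≤-Reasoning
    p = vm x
    q = vm (x + 2)
    t = N ∸ 2 ∸ r
    vm-pred≡vm+3 : vm (x + (M ∸ 1)) ≡ vm (x + 3)
    vm-pred≡vm+3 = cong (λ k → vm (x + (k ∸ 1))) M≡4
    p~vm+3 : p ~ vm (x + 3)
    p~vm+3 = subst (p ~_) vm-pred≡vm+3 (vm~vm-pred x)
    p≢vm+3 : p ≢ vm (x + 3)
    p≢vm+3 = subst (p ≢_) vm-pred≡vm+3 (vm≢vm-pred x)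

  InX⇒ : ∀ {c} → InX N M v c → Draconian (K N) c × ¬ Draconian K∖C c
  InX⇒ {c} (i , j , c≡) = draconian-K (sum-X c≡) , ¬draconian-X (toℕ i) j c≡′
    where
    c≡′ : ∀ k → c k ≡ (N ∸ 2) * e (vm (toℕ i)) k + e j k
    c≡′ k = subst (λ a → c k ≡ (N ∸ 2) * e a k + e j k) (sym (vm-toℕ i)) (c≡ k)

  InY⇒ : ∀ {c} → InY N M v c → Draconian (K N) c × ¬ Draconian K∖C c
  InY⇒ (i , r , _ , r≤N∸3 , c≡) = draconian-K (sum-Y r≤N∸3 c≡) , ¬draconian-Y (toℕ i) r≤N∸3 c≡

  InZ⇒ : M ≡ 4 → ∀ {c} → InZ N M v c → Draconian (K N) c × ¬ Draconian K∖C c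
  InZ⇒ M≡4 (i , r , _ , r≤N∸3 , _ , _ , _ , c≡) = draconian-K (sum-Z r≤N∸3 c≡) , ¬draconian-Z M≡4 (toℕ i) r≤N∸3 c≡

  InX⇒large : ∀ {c} → InX N M v c → ∃[ a ] N ∸ 2 ≤ c a
  InX⇒large (i , j , c≡) = v i , N∸2≤c-X c≡

  InY⇒values : ∀ {c} → InY N M v c → ∀ k → c k ≤ N ∸ 3 × c k ≢ 1
  InY⇒values {c} (i , r , 2≤r , r≤N∸3 , c≡) k =
    subst (_≤ N ∸ 3) (sym (c≡ k)) (*e+*e≤ (vm≢vm+2 (toℕ i)) r≤N∸3 t≤N∸3 k) ,
    subst (_≢ 1) (sym (c≡ k)) (*e+*e≢1 (vm≢vm+2 (toℕ i)) (2≤⇒≢1 2≤r) (2≤⇒≢1 2≤t) k)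
    where
    t = N ∸ 1 ∸ r
    t≤N∸3 : t ≤ N ∸ 3
    t≤N∸3 = ≤-trans (∸-monoʳ-≤ (N ∸ 1) 2≤r) (≤-reflexive (cong (_∸ 2) N∸1≡2+[N∸3]))
    2≤t : 2 ≤ t
    2≤t = begin
      2                          ≡⟨ m+n∸n≡m 2 (N ∸ 3) ⟨
      2 + (N ∸ 3) ∸ (N ∸ 3)      ≡⟨ cong (_∸ (N ∸ 3)) N∸1≡2+[N∸3] ⟨
      N ∸ 1 ∸ (N ∸ 3)            ≤⟨ ∸-monoʳ-≤ (N ∸ 1) r≤N∸3 ⟩
      t                          ∎
      where open ≤-Reasoning

  InZ⇒one : ∀ {c} → InZ N M v c → ∃[ s ] c s ≡ 1
  InZ⇒one {c} (i , r , _ , _ , s , s≢p , s≢q , c≡) = s , (begin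
    c s                                                               ≡⟨ c≡ s ⟩
    r * e (vm (toℕ i)) s + (N ∸ 2 ∸ r) * e (vm (toℕ i + 2)) s + e s s  ≡⟨ cong₂ _+_ (cong₂ _+_
                                                                           (*-e-off r (s≢p ∘ sym)) (*-e-off (N ∸ 2 ∸ r) (s≢q ∘ sym))) (e-diag s) ⟩
    1                                                                 ∎)
    where open ≡-Reasoning

  InZ⇒values : ∀ {c} → InZ N M v c → ∀ k → c k ≤ N ∸ 3
  InZ⇒values {c} z@(i , r , 1≤r , r≤N∸3 , s , _ , _ , c≡) k = bound (s F.≟ k)
    where
    t = N ∸ 2 ∸ r
    t≤N∸3 : t ≤ N ∸ 3
    t≤N∸3 = ≤-trans (∸-monoʳ-≤ (N ∸ 2) 1≤r) (≤-reflexive (cong (_∸ 1) N∸2≡1+[N∸3]))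
    bound : Dec (s ≡ k) → c k ≤ N ∸ 3
    bound (yes refl) = subst (_≤ N ∸ 3) (sym (proj₂ (InZ⇒one z))) 1≤N∸3
    bound (no s≢k) = subst (_≤ N ∸ 3) (sym (trans (c≡ k) (trans (cong (_ +_) (e-off s≢k)) (+-identityʳ _))))
                       (*e+*e≤ (vm≢vm+2 (toℕ i)) r≤N∸3 t≤N∸3 k)

  𝒳∩𝒴≡∅ : ∀ c → ¬ (InX N M v c × InY N M v c)
  𝒳∩𝒴≡∅ c (x , y) with InX⇒large x
  ... | a , N∸2≤c[a] = <⇒≱ N∸3<N∸2 (≤-trans N∸2≤c[a] (proj₁ (InY⇒values y a)))

  𝒳∩𝒵≡∅ : ∀ c → ¬ (InX N M v c × InZ N M v c)
  𝒳∩𝒵≡∅ c (x , z) with InX⇒large x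
  ... | a , N∸2≤c[a] = <⇒≱ N∸3<N∸2 (≤-trans N∸2≤c[a] (InZ⇒values z a))

  𝒴∩𝒵≡∅ : ∀ c → ¬ (InY N M v c × InZ N M v c)
  𝒴∩𝒵≡∅ c (y , z) with InZ⇒one z
  ... | s , c[s]≡1 = proj₂ (InY⇒values y s) c[s]≡1

  InX-intro : ∀ {c : Fin N → ℕ} x → sumF c ≡ N ∸ 1 → N ∸ 2 ≤ c (vm x) → InX N M v c
  InX-intro {c} x Σc N∸2≤c[a] = x mod M , j , λ k → trans (sym (m+[n∸m]≡n (f≤c k))) (cong (f k +_) (rest≡e k))
    where
    a = vm x
    f : Fin N → ℕ
    f k = (N ∸ 2) * e a k
    f≤c : ∀ k → f k ≤ c k
    f≤c k with a F.≟ k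
    ... | yes refl = subst (_≤ c a) (sym (*-identityʳ (N ∸ 2))) N∸2≤c[a]
    ... | no _ = subst (_≤ c k) (sym (*-zeroʳ (N ∸ 2))) z≤n
    rest : Fin N → ℕ
    rest k = c k ∸ f k
    Σrest≡1 : sum rest ≡ 1
    Σrest≡1 = +-cancelˡ-≡ (N ∸ 2) (sum rest) 1 (begin
      N ∸ 2 + sum rest           ≡⟨ cong (_+ sum rest) (sum-*e (N ∸ 2) a) ⟨
      sum f + sum rest           ≡⟨ ∑-distrib-+ f rest ⟨
      sum (λ k → f k + rest k)   ≡⟨ sum-cong-≗ (λ k → m+[n∸m]≡n (f≤c k)) ⟩
      sum c                      ≡⟨ sumF≡sum c ⟨
      sumF c                     ≡⟨ Σc ⟩
      N ∸ 1                      ≡⟨ N∸2+1≡N∸1 ⟨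
      N ∸ 2 + 1                  ∎)
      where open ≡-Reasoning
    j : Fin N
    j = proj₁ (sum≡1⇒≡e rest Σrest≡1)
    rest≡e : ∀ k → rest k ≡ e j k
    rest≡e = proj₂ (sum≡1⇒≡e rest Σrest≡1)

  InY-intro : ∀ {c : Fin N → ℕ} x {a b} → a + b ≡ N ∸ 1 → a ≤ N ∸ 3 → b ≤ N ∸ 3 →
    (∀ k → c k ≡ a * e (vm x) k + b * e (vm (x + 2)) k) → InY N M v c
  InY-intro {c} x {a} {b} a+b≡N∸1 a≤N∸3 b≤N∸3 c≡ = x mod M , a , 2≤a , a≤N∸3 , c≡′
    where
    N∸1∸a≡b : N ∸ 1 ∸ a ≡ b
    N∸1∸a≡b = trans (cong (_∸ a) (sym a+b≡N∸1)) (m+n∸m≡n a b)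
    c≡′ : ∀ k → c k ≡ a * e (vm (toℕ (x mod M))) k + (N ∸ 1 ∸ a) * e (vm (toℕ (x mod M) + 2)) k
    c≡′ k rewrite vm-toℕ (x mod M) | vm-toℕ-mod+ x 2 | N∸1∸a≡b = c≡ k
    2≤a : 2 ≤ a
    2≤a = +-cancelʳ-≤ b 2 a (begin
      2 + b             ≤⟨ +-monoʳ-≤ 2 b≤N∸3 ⟩
      2 + (N ∸ 3)       ≡⟨ N∸1≡2+[N∸3] ⟨
      N ∸ 1             ≡⟨ a+b≡N∸1 ⟨
      a + b             ∎)
      where open ≤-Reasoning

  InZ-intro : ∀ {c : Fin N → ℕ} x {a b} {s : Fin N} → s ≢ vm x → s ≢ vm (x + 2) →
    a + b ≡ N ∸ 2 → a ≤ N ∸ 3 → b ≤ N ∸ 3 →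
    (∀ k → c k ≡ a * e (vm x) k + b * e (vm (x + 2)) k + e s k) → InZ N M v c
  InZ-intro {c} x {a} {b} {s} s≢p s≢q a+b≡N∸2 a≤N∸3 b≤N∸3 c≡ =
    x mod M , a , 1≤a , a≤N∸3 , s , s≢p′ , s≢q′ , c≡′
    where
    N∸2∸a≡b : N ∸ 2 ∸ a ≡ b
    N∸2∸a≡b = trans (cong (_∸ a) (sym a+b≡N∸2)) (m+n∸m≡n a b)
    s≢p′ : s ≢ vm (toℕ (x mod M))
    s≢p′ rewrite vm-toℕ (x mod M) = s≢p
    s≢q′ : s ≢ vm (toℕ (x mod M) + 2)
    s≢q′ rewrite vm-toℕ-mod+ x 2 = s≢q
    c≡′ : ∀ k → c k ≡ a * e (vm (toℕ (x mod M))) k + (N ∸ 2 ∸ a) * e (vm (toℕ (x mod M) + 2)) k + e s k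
    c≡′ k rewrite vm-toℕ (x mod M) | vm-toℕ-mod+ x 2 | N∸2∸a≡b = c≡ k
    1≤a : 1 ≤ a
    1≤a = +-cancelʳ-≤ b 1 a (begin
      1 + b             ≤⟨ +-monoʳ-≤ 1 b≤N∸3 ⟩
      1 + (N ∸ 3)       ≡⟨ N∸2≡1+[N∸3] ⟨
      N ∸ 2             ≡⟨ a+b≡N∸2 ⟨
      a + b             ∎)
      where open ≤-Reasoning

  InX⊎bounded : ∀ {c : Fin N → ℕ} x → sumF c ≡ N ∸ 1 →
    InX N M v c ⊎ (c (vm x) ≤ N ∸ 3 × c (vm (x + 2)) ≤ N ∸ 3)
  InX⊎bounded {c} x Σc with N ∸ 2 ≤? c (vm x) | N ∸ 2 ≤? c (vm (x + 2))
  ... | yes large | _ = inj₁ (InX-intro x Σc large)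
  ... | no _ | yes large = inj₁ (InX-intro (x + 2) Σc large)
  ... | no p-small | no q-small = inj₂ (≰N∸2⇒≤N∸3 p-small , ≰N∸2⇒≤N∸3 q-small)

  classify-two-point : ∀ {c : Fin N → ℕ} x → sumF c ≡ N ∸ 1 →
    (∀ k → c k ≡ c (vm x) * e (vm x) k + c (vm (x + 2)) * e (vm (x + 2)) k) → InX N M v c ⊎ InY N M v c
  classify-two-point {c} x Σc c≡ = map₂ (λ (p≤ , q≤) → InY-intro x cp+cq≡N∸1 p≤ q≤ c≡) (InX⊎bounded x Σc)
    where
    cp+cq≡N∸1 : c (vm x) + c (vm (x + 2)) ≡ N ∸ 1
    cp+cq≡N∸1 = begin
      c (vm x) + c (vm (x + 2))  ≡⟨ sum-*e+*e (c (vm x)) (c (vm (x + 2))) (vm x) (vm (x + 2)) ⟨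
      sum (λ k → c (vm x) * e (vm x) k + c (vm (x + 2)) * e (vm (x + 2)) k) ≡⟨ sum-cong-≗ c≡ ⟨
      sum c                      ≡⟨ sumF≡sum c ⟨
      sumF c                     ≡⟨ Σc ⟩
      N ∸ 1                      ∎
      where open ≡-Reasoning

  classify-three-point : ∀ {c : Fin N → ℕ} x {s : Fin N} → s ≢ vm x → s ≢ vm (x + 2) → sumF c ≡ N ∸ 1 →
    (∀ k → c k ≡ c (vm x) * e (vm x) k + c (vm (x + 2)) * e (vm (x + 2)) k + e s k) → InX N M v c ⊎ InZ N M v c
  classify-three-point {c} x {s} s≢p s≢q Σc c≡ =
    map₂ (λ (p≤ , q≤) → InZ-intro x s≢p s≢q cp+cq≡N∸2 p≤ q≤ c≡) (InX⊎bounded x Σc)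
    where
    cp+cq≡N∸2 : c (vm x) + c (vm (x + 2)) ≡ N ∸ 2
    cp+cq≡N∸2 = +-cancelʳ-≡ 1 _ _ (begin
      c (vm x) + c (vm (x + 2)) + 1  ≡⟨ cong₂ _+_ (sum-*e+*e (c (vm x)) (c (vm (x + 2))) (vm x) (vm (x + 2))) (sum-e s) ⟨
      sum (λ k → c (vm x) * e (vm x) k + c (vm (x + 2)) * e (vm (x + 2)) k) + sum (e s)
                                     ≡⟨ ∑-distrib-+ (λ k → c (vm x) * e (vm x) k + c (vm (x + 2)) * e (vm (x + 2)) k) (e s) ⟨
      sum (λ k → c (vm x) * e (vm x) k + c (vm (x + 2)) * e (vm (x + 2)) k + e s k)
                                     ≡⟨ sum-cong-≗ c≡ ⟨
      sum c                          ≡⟨ sumF≡sum c ⟨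
      sumF c                         ≡⟨ Σc ⟩
      N ∸ 1                          ≡⟨ N∸2+1≡N∸1 ⟨
      N ∸ 2 + 1                      ∎)
      where open ≡-Reasoning

  InXYZ : (Fin N → ℕ) → Set
  InXYZ c = InX N M v c ⊎ InY N M v c ⊎ (M ≡ 4 × InZ N M v c)

  classify-single : ∀ {c : Fin N → ℕ} {S} y → sumF c ≡ N ∸ 1 → Violating K∖C c S →
    (∀ {k} → k ∈ S → k ≡ vm y) → InX N M v c
  classify-single {c} {S} y Σc ((f , f∈S) , ∣U∣≤ΣSc) S⊆y = InX-intro y Σc (begin
    N ∸ 2                    ≤⟨ n∸2≤∣p∣ (λ w∉U → ~-neighbours y (∉U⇒~ w∉U vm[y]∈S)) ⟩
    ∣ nbrUnionD K∖C S ∣       ≤⟨ ∣U∣≤ΣSc ⟩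
    sumOn S c                ≤⟨ sumOn-⊆⁅⁆ S c S⊆y ⟩
    c (vm y)                 ∎)
    where
    open ≤-Reasoning
    vm[y]∈S : vm y ∈ S
    vm[y]∈S = subst (_∈ S) (S⊆y f∈S) f∈S

  classify-one-unit-outside : ∀ {c : Fin N → ℕ} {S} i → sumF c ≡ N ∸ 1 → vm i ∈ S → vm (i + 2) ∈ S →
    (∀ k → c k ≡ c (vm i) * e (vm i) k + c (vm (i + 2)) * e (vm (i + 2)) k + restrict (∁ S) c k) →
    N ∸ 2 + sum (restrict (∁ S) c) ≡ N ∸ 1 → InX N M v c ⊎ InZ N M v c
  classify-one-unit-outside {c} {S} i Σc p∈S q∈S c≡ N∸2+Σrest≡N∸1 =
    classify-three-point i s≢p s≢q Σc λ k → trans (c≡ k) (cong (c p * e p k + c q * e q k +_) (rest≡e k))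
    where
    p = vm i
    q = vm (i + 2)
    rest = restrict (∁ S) c
    Σrest≡1 : sum rest ≡ 1
    Σrest≡1 = +-cancelˡ-≡ (N ∸ 2) (sum rest) 1 (trans N∸2+Σrest≡N∸1 (sym N∸2+1≡N∸1))
    s : Fin N
    s = proj₁ (sum≡1⇒≡e rest Σrest≡1)
    rest≡e : ∀ k → rest k ≡ e s k
    rest≡e = proj₂ (sum≡1⇒≡e rest Σrest≡1)
    s∉S : s ∉ S
    s∉S s∈S = contradiction (trans (sym (restrict-∉ (∁ S) c (x∈p⇒x∉∁p s∈S))) (trans (rest≡e s) (e-diag s))) λ ()
    s≢p : s ≢ p
    s≢p s≡p = s∉S (subst (_∈ S) (sym s≡p) p∈S)
    s≢q : s ≢ q
    s≢q s≡q = s∉S (subst (_∈ S) (sym s≡q) q∈S)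

  classify-pair : ∀ {c : Fin N → ℕ} {S} i → sumF c ≡ N ∸ 1 → Violating K∖C c S → vm i ∈ S → vm (i + 2) ∈ S →
    (∀ {k} → k ∈ S → k ≡ vm i ⊎ k ≡ vm (i + 2)) → InXYZ c
  classify-pair {c} {S} i Σc (_ , ∣U∣≤ΣSc) p∈S q∈S S⊆pq = by-mass (N ∸ 1 ≤? c p + c q)
    where
    p = vm i
    q = vm (i + 2)
    A = c p + c q
    rest = restrict (∁ S) c
    ∣U∣≤A : ∣ nbrUnionD K∖C S ∣ ≤ A
    ∣U∣≤A = subst (_ ≤_) (sumOn-pair S c (vm≢vm+2 i) p∈S q∈S S⊆pq) ∣U∣≤ΣSc
    A+Σrest≡N∸1 : A + sum rest ≡ N ∸ 1
    A+Σrest≡N∸1 = begin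
      A + sum rest                  ≡⟨ cong₂ _+_ (sumOn-pair S c (vm≢vm+2 i) p∈S q∈S S⊆pq) (sumOn≡sum (∁ S) c) ⟨
      sumOn S c + sumOn (∁ S) c     ≡⟨ sumF≡sumOn+sumOn∁ S c ⟨
      sumF c                        ≡⟨ Σc ⟩
      N ∸ 1                         ∎
      where open ≡-Reasoning
    c≡ : ∀ k → c k ≡ c p * e p k + c q * e q k + rest k
    c≡ k = trans (sym (restrict+restrict-∁ S c k)) (cong (_+ rest k) (restrict-pair S c (vm≢vm+2 i) p∈S q∈S S⊆pq k))
    missing : ∀ {w} → w ∉ nbrUnionD K∖C S → w ≡ vm (i + 1) ⊎ (M ≡ 4 × w ≡ vm (i + 3))
    missing w∉U = common-neighbour i (∉U⇒~ w∉U p∈S) (∉U⇒~ w∉U q∈S)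

    missing≢4 : M ≢ 4 → ∀ {w} → w ∉ nbrUnionD K∖C S → w ≡ vm (i + 1)
    missing≢4 M≢4 w∉U = common-neighbour-≢4 M≢4 i (∉U⇒~ w∉U p∈S) (∉U⇒~ w∉U q∈S)

    by-mass : Dec (N ∸ 1 ≤ A) → InXYZ c
    by-mass (yes N∸1≤A) = [ inj₁ , inj₂ ∘ inj₁ ]′ (classify-two-point i Σc λ k →
      trans (c≡ k) (trans (cong (c p * e p k + c q * e q k +_) (sum≡0⇒≡0 rest Σrest≡0 k)) (+-identityʳ _)))
      where
      Σrest≡0 : sum rest ≡ 0
      Σrest≡0 = n≤0⇒n≡0 (+-cancelˡ-≤ A _ _ (≤-trans (≤-reflexive A+Σrest≡N∸1) (≤-trans N∸1≤A (≤-reflexive (sym (+-identityʳ A))))))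
    by-mass (no N∸1≰A) = [ inj₁ , (λ Z → inj₂ (inj₂ (M≡4 , Z))) ]′
      (classify-one-unit-outside i Σc p∈S q∈S c≡ (subst (λ a → a + sum rest ≡ N ∸ 1) A≡N∸2 A+Σrest≡N∸1))
      where
      M≡4 : M ≡ 4
      M≡4 = decidable-stable (M ℕ.≟ 4) λ M≢4 → N∸1≰A (≤-trans (n∸1≤∣p∣ (missing≢4 M≢4)) ∣U∣≤A)
      A≡N∸2 : A ≡ N ∸ 2
      A≡N∸2 = ≤-antisym (≤-pred (subst (suc A ≤_) N∸1≡1+[N∸2] (≰⇒> N∸1≰A)))
                        (≤-trans (n∸2≤∣p∣ (map₂ proj₂ ∘ missing)) ∣U∣≤A)

  classify-around : ∀ {c : Fin N → ℕ} {S} x → sumF c ≡ N ∸ 1 → Violating K∖C c S → vm x ∉ nbrUnionD K∖C S → InXYZ c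
  classify-around {c} {S} x Σc violating@((f , f∈S) , _) w∉U = by-membership (p ∈? S) (q ∈? S)
    where
    -- v_x is adjacent to every vertex of S, so S lies inside its two cycle-neighbours vm i and vm (i + 2).
    i = x + (M ∸ 1)
    p = vm i
    q = vm (i + 2)
    S⊆pq : ∀ {k} → k ∈ S → k ≡ p ⊎ k ≡ q
    S⊆pq k∈S = [ (λ k≡x+1 → inj₂ (trans k≡x+1 (sym (vm-pred+suc x 1)))) , inj₁ ]′
      (~-neighbours x (~-sym (∉U⇒~ w∉U k∈S)))
    by-membership : Dec (p ∈ S) → Dec (q ∈ S) → InXYZ c
    by-membership (yes p∈S) (yes q∈S) = classify-pair i Σc violating p∈S q∈S S⊆pq
    by-membership (yes _) (no q∉S) = inj₁ (classify-single i Σc violating λ k∈S →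
      [ id , (λ { refl → contradiction k∈S q∉S }) ]′ (S⊆pq k∈S))
    by-membership (no p∉S) (yes _) = inj₁ (classify-single (i + 2) Σc violating λ k∈S →
      [ (λ { refl → contradiction k∈S p∉S }) , id ]′ (S⊆pq k∈S))
    by-membership (no p∉S) (no q∉S) = ⊥-elim $
      [ (λ f≡p → p∉S (subst (_∈ S) f≡p f∈S)) , (λ f≡q → q∉S (subst (_∈ S) f≡q f∈S)) ]′ (S⊆pq f∈S)

  classify : ∀ {c : Fin N → ℕ} → Draconian (K N) c → ¬ Draconian K∖C c → InXYZ c
  classify {c} (Σc , _) ¬draconian =
    let S , violating = ¬draconian⇒violating {H = K∖C} Σc ¬draconian
        w , w∉U = violating⇒missing {H = K∖C} Σc violating
        x , w≡vm[x] = ~⇒vm (∉U⇒~ w∉U (proj₂ (proj₁ violating)))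
    in classify-around x Σc violating (subst (_∉ nbrUnionD K∖C S) w≡vm[x] w∉U)

lemma3p4 : (N M : ℕ) .{{_ : NonZero M}} → 5 ≤ N → 3 ≤ M → M ≤ N →
    (v : Fin M → Fin N) → Injective _≡_ _≡_ v →
    (∀ c → ¬ (InX N M v c × InY N M v c)) ×
    (M ≡ 4 → (∀ c → ¬ (InX N M v c × InZ N M v c)) × (∀ c → ¬ (InY N M v c × InZ N M v c))) ×
    (M ≢ 4 → ∀ (c : Fin N → ℕ) →
      ((Draconian (K N) c × ¬ Draconian (KminusCycle N M v) c) → (InX N M v c ⊎ InY N M v c)) ×
      ((InX N M v c ⊎ InY N M v c) → (Draconian (K N) c × ¬ Draconian (KminusCycle N M v) c))) ×
    (M ≡ 4 → ∀ (c : Fin N → ℕ) →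
      ((Draconian (K N) c × ¬ Draconian (KminusCycle N M v) c) → (InX N M v c ⊎ InY N M v c ⊎ InZ N M v c)) ×
      ((InX N M v c ⊎ InY N M v c ⊎ InZ N M v c) → (Draconian (K N) c × ¬ Draconian (KminusCycle N M v) c)))
lemma3p4 N M 5≤N 3≤M _ v v-injective =
  𝒳∩𝒴≡∅ , (λ _ → 𝒳∩𝒵≡∅ , 𝒴∩𝒵≡∅) ,
  (λ M≢4 c → without-𝒵 M≢4 ∘ uncurry classify , [ InX⇒ , InY⇒ ]′) ,
  (λ M≡4 c → map₂ (map₂ proj₂) ∘ uncurry classify , [ InX⇒ , [ InY⇒ , InZ⇒ M≡4 ]′ ]′)
  where
  open Classification 5≤N 3≤M v v-injective
  without-𝒵 : M ≢ 4 → ∀ {c} → InXYZ c → InX N M v c ⊎ InY N M v c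
  without-𝒵 M≢4 = map₂ [ id , (λ (M≡4 , _) → contradiction M≡4 M≢4) ]′
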